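{- Let $k\ge 2$ and let $p$ be either $1$ or a prime. Then for all $n\ge 0$, $$a_{p,k}(n+1)-a_{p,k}(n)=a_{p,k-1}(n).$$
   Context: A partition of $n$ is a weakly decreasing finite sequence of positive integers summing to $n$; $\mathcal P(n)$ is the set of partitions of $n$ (the empty partition being the unique partition of $0$). For a partition $\lambda$ and positive integer $i$, $m_\lambda(i)$ is the number of parts equal to $i$. For $\lambda=(\lambda_1,\ldots,\lambda_\ell)$ with $\ell\ge k$, $\mathrm{pre}_k(\lambda)$ is the partition whose parts are the $\binom{\ell}{k}$ products $\lambda_{i_1}\cdots\lambda_{i_k}$ over all $1\le i_1<\cdots<i_k\le\ell$ (with multiplicity); it is undefined if $\ell<k$. In particular $\mathrm{pre}_1(\lambda)=\lambda$. $\mathrm{pre}_k(\mathcal P(n))$ is the set of $\mathrm{pre}_k(\lambda)$ for $\lambda\in\mathcal P(n)$ with at least $k$ parts, and $a_{i,k}(n)=\sum_{\nu\in\mathrm{pre}_k(\mathcal P(n))} m_\nu(i)$. -}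

module Defs where

open import Data.Nat using (ℕ; zero; suc; _+_; _*_; _≤_; _<_; _≥_; _≟_)
open import Data.List using (List; []; _∷_; _++_; map; length; filter)
open import Data.Nat.ListAction using (sum; product)
open import Data.List.Relation.Unary.All using (All)
open import Data.List.Relation.Unary.Linked using (Linked)
open import Data.List.Membership.Propositional using (_∈_)
open import Data.List.Relation.Unary.Unique.Propositional using (Unique)
open import Data.Product using (_×_)
open import Function.Bundles using (_⇔_)
open import Data.Nat using (_≤?_)
open import Relation.Binary.PropositionalEquality using (_≡_)

IsPartition : ℕ → List ℕ → Set
IsPartition n λs = Linked _≥_ λs × All (0 <_) λs × sum λs ≡ n

Enumerates : (ℕ → List (List ℕ)) → Set
Enumerates ps = ∀ n → Unique (ps n) × (∀ λs → (λs ∈ ps n) ⇔ IsPartition n λs)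

-- All k-element sub-multisets of a list chosen by index positions
-- i₁ < … < i_k (with multiplicity): one entry per index subset.
choose : ℕ → List ℕ → List (List ℕ)
choose zero    _        = [] ∷ []
choose (suc k) []       = []
choose (suc k) (x ∷ xs) = map (x ∷_) (choose k xs) ++ choose (suc k) xs

pre : ℕ → List ℕ → List ℕ
pre k λs = map product (choose k λs)

mult : List ℕ → ℕ → ℕ
mult ν i = length (filter (i ≟_) ν)

a : (ℕ → List (List ℕ)) → ℕ → ℕ → ℕ → ℕ
a ps i k n = sum (map (λ λs → mult (pre k λs) i) (filter (λ λs → k ≤? length λs) (ps n)))

-- A partition of n + 1 containing a part 1 is μ ++ [1] with μ a partition of n, and this is a
-- bijection. Partitions of n + 1 without a part 1 contribute nothing: with k ≥ 2, every entry of
-- pre_k is a product of at least two factors ≥ 2, hence composite, hence neither 1 nor prime.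
-- Finally, the (k+1)-subsets of μ ++ [1] are the (k+1)-subsets of μ together with the k-subsets
-- of μ extended by the part 1, which does not change the product; so appending 1 adds exactly
-- the multiplicities of pre_k(μ) to those of pre_{k+1}(μ).
module Submission where

open import Defs
open import Algebra.Bundles using (CommutativeMonoid)
import Algebra.Properties.CommutativeSemigroup as CommutativeSemigroupProperties
open import Data.Nat using (ℕ; zero; suc; _+_; _*_; _∸_; _≤_; _<_; _≥_; _≟_; _≤?_; z≤n; s≤s; >-nonZero)
open import Data.Nat.Properties using (+-commutativeSemigroup; +-comm; *-identityʳ; m<m*n; ≤-trans; ≤-antisym; <⇒≤; ≰⇒>; m<n⇒m<1+n; suc-injective; ≤∧≢⇒<)
open import Data.Nat.Primality using (Prime; Composite; composite; composite⇒nonTrivial; prime⇒¬composite)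
open import Data.Nat.Divisibility using (m∣m*n)
open import Data.Nat.ListAction using (sum; product)
open import Data.Nat.ListAction.Properties using (sum-++; sum-↭; product-++; ∈⇒≤product)
open import Data.Sum using (_⊎_; inj₁; inj₂)
open import Data.List using (List; []; _∷_; _++_; _∷ʳ_; map; length; filter)
open import Data.List.Properties using (map-++; filter-++; length-++; map-∘; map-cong; filter-none; ∷ʳ-injectiveˡ)
open import Data.List.Relation.Unary.All as All using (All; []; _∷_)
import Data.List.Relation.Unary.All.Properties as All
open import Data.List.Relation.Unary.Any using (here; there)
open import Data.List.Relation.Unary.Linked using (Linked; []; [-]; _∷_)
open import Data.List.Membership.Propositional using (_∈_; _∉_)
open import Data.List.Membership.Propositional.Properties using (∈-map⁺; ∈-map⁻; ∈-++⁺ʳ; ∈-filter⁺; ∈-filter⁻)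
open import Data.List.Membership.Propositional.Properties.WithK using (unique∧set⇒bag)
open import Data.List.Membership.DecPropositional _≟_ using (_∈?_)
import Data.List.Relation.Unary.Unique.Propositional.Properties as Unique
open import Data.List.Relation.Binary.BagAndSetEquality using (∼bag⇒↭)
open import Data.List.Relation.Binary.Permutation.Propositional using (_↭_; ↭-refl; prep; module PermutationReasoning)
open import Data.List.Relation.Binary.Permutation.Propositional.Properties using (++⁺; map⁺; filter-↭; ↭-length; ++-commutativeMonoid)
open import Data.Product as Product using (_×_; _,_; proj₁; proj₂; ∃-syntax)
open import Function.Base using (_∘_)
open import Function.Bundles using (mk⇔; Equivalence)
open import Relation.Nullary using (¬_; yes; no)
open import Relation.Unary using (Decidable)
open import Relation.Binary.PropositionalEquality using (_≡_; _≢_; refl; sym; trans; cong; cong₂; subst; module ≡-Reasoning)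

private
  module ℕ+ = CommutativeSemigroupProperties +-commutativeSemigroup
  module ++↭ {A : Set} = CommutativeSemigroupProperties (CommutativeMonoid.commutativeSemigroup (++-commutativeMonoid {A = A}))

sum-map-+ : ∀ {A : Set} (f g : A → ℕ) xs →
            sum (map (λ x → f x + g x) xs) ≡ sum (map f xs) + sum (map g xs)
sum-map-+ f g [] = refl
sum-map-+ f g (x ∷ xs) = trans (cong (f x + g x +_) (sum-map-+ f g xs))
                               (ℕ+.interchange (f x) (g x) _ _)

sum-map-filter : ∀ {A : Set} {P : A → Set} (P? : Decidable P) (f : A → ℕ) xs →
                 (∀ {x} → x ∈ xs → ¬ P x → f x ≡ 0) →
                 sum (map f (filter P? xs)) ≡ sum (map f xs)
sum-map-filter P? f [] _ = refl
sum-map-filter P? f (x ∷ xs) f≡0 with P? x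
... | yes _  = cong (f x +_) (sum-map-filter P? f xs (f≡0 ∘ there))
... | no ¬Px = trans (sum-map-filter P? f xs (f≡0 ∘ there))
                   (cong (_+ sum (map f xs)) (sym (f≡0 (here refl) ¬Px)))

choose-short : ∀ k xs → length xs < k → choose k xs ≡ []
choose-short (suc k)       []       _          = refl
choose-short (suc zero)    (x ∷ xs) (s≤s ())
choose-short (suc (suc k)) (x ∷ xs) (s≤s <k+2) =
  cong₂ (λ ys zs → map (x ∷_) ys ++ zs) (choose-short (suc k) xs <k+2) (choose-short (suc (suc k)) xs (m<n⇒m<1+n <k+2))

length-choose : ∀ k xs → All (λ s → length s ≡ k) (choose k xs)
length-choose zero    _        = refl ∷ []
length-choose (suc k) []       = []
length-choose (suc k) (x ∷ xs) =
  All.++⁺ (All.map⁺ (All.map (cong suc) (length-choose k xs))) (length-choose (suc k) xs)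

All-choose : ∀ {P : ℕ → Set} k {xs} → All P xs → All (All P) (choose k xs)
All-choose zero    _           = [] ∷ []
All-choose (suc k) []          = []
All-choose (suc k) (px ∷ pxs) =
  All.++⁺ (All.map⁺ (All.map (px ∷_) (All-choose k pxs))) (All-choose (suc k) pxs)

choose-∷ʳ : ∀ k xs y → choose (suc k) (xs ∷ʳ y) ↭ choose (suc k) xs ++ map (_∷ʳ y) (choose k xs)
choose-∷ʳ zero    []       y = ↭-refl
choose-∷ʳ (suc k) []       y = ↭-refl
choose-∷ʳ zero    (x ∷ xs) y = prep (x ∷ []) (choose-∷ʳ zero xs y)
choose-∷ʳ (suc k) (x ∷ xs) y = begin
  map (x ∷_) (choose (suc k) (xs ∷ʳ y)) ++ choose (suc (suc k)) (xs ∷ʳ y)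
    ↭⟨ ++⁺ (map⁺ (x ∷_) (choose-∷ʳ k xs y)) (choose-∷ʳ (suc k) xs y) ⟩
  map (x ∷_) (C₁ ++ map (_∷ʳ y) C₀) ++ (C₂ ++ map (_∷ʳ y) C₁)
    ≡⟨ cong (_++ (C₂ ++ map (_∷ʳ y) C₁)) (map-++ (x ∷_) C₁ _) ⟩
  (map (x ∷_) C₁ ++ map (x ∷_) (map (_∷ʳ y) C₀)) ++ (C₂ ++ map (_∷ʳ y) C₁)
    ↭⟨ ++↭.interchange (map (x ∷_) C₁) _ C₂ _ ⟩
  (map (x ∷_) C₁ ++ C₂) ++ (map (x ∷_) (map (_∷ʳ y) C₀) ++ map (_∷ʳ y) C₁)
    ≡⟨ cong (λ zs → (map (x ∷_) C₁ ++ C₂) ++ (zs ++ map (_∷ʳ y) C₁)) (trans (sym (map-∘ C₀)) (map-∘ C₀)) ⟩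
  (map (x ∷_) C₁ ++ C₂) ++ (map (_∷ʳ y) (map (x ∷_) C₀) ++ map (_∷ʳ y) C₁)
    ≡⟨ cong ((map (x ∷_) C₁ ++ C₂) ++_) (map-++ (_∷ʳ y) (map (x ∷_) C₀) C₁) ⟨
  (map (x ∷_) C₁ ++ C₂) ++ map (_∷ʳ y) (map (x ∷_) C₀ ++ C₁) ∎
  where
  open PermutationReasoning
  C₀ = choose k xs
  C₁ = choose (suc k) xs
  C₂ = choose (suc (suc k)) xs

pre-∷ʳ1 : ∀ k xs → pre (suc k) (xs ∷ʳ 1) ↭ pre (suc k) xs ++ pre k xs
pre-∷ʳ1 k xs = begin
  map product (choose (suc k) (xs ∷ʳ 1))
    ↭⟨ map⁺ product (choose-∷ʳ k xs 1) ⟩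
  map product (choose (suc k) xs ++ map (_∷ʳ 1) (choose k xs))
    ≡⟨ map-++ product (choose (suc k) xs) _ ⟩
  pre (suc k) xs ++ map product (map (_∷ʳ 1) (choose k xs))
    ≡⟨ cong (pre (suc k) xs ++_) (trans (sym (map-∘ (choose k xs))) (map-cong product-∷ʳ1 (choose k xs))) ⟩
  pre (suc k) xs ++ pre k xs ∎
  where
  open PermutationReasoning
  product-∷ʳ1 : ∀ s → product (s ∷ʳ 1) ≡ product s
  product-∷ʳ1 s = trans (product-++ s (1 ∷ [])) (*-identityʳ (product s))

mult-++ : ∀ ν ν′ i → mult (ν ++ ν′) i ≡ mult ν i + mult ν′ i
mult-++ ν ν′ i = trans (cong length (filter-++ (i ≟_) ν ν′)) (length-++ (filter (i ≟_) ν))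

mult-↭ : ∀ {ν ν′} i → ν ↭ ν′ → mult ν i ≡ mult ν′ i
mult-↭ i ν↭ν′ = ↭-length (filter-↭ (i ≟_) ν↭ν′)

mult-pre-∷ʳ1 : ∀ k xs i → mult (pre (suc k) (xs ∷ʳ 1)) i ≡ mult (pre (suc k) xs) i + mult (pre k xs) i
mult-pre-∷ʳ1 k xs i = trans (mult-↭ i (pre-∷ʳ1 k xs)) (mult-++ (pre (suc k) xs) (pre k xs) i)

*-composite : ∀ {m n} → 2 ≤ m → 2 ≤ n → Composite (m * n)
*-composite {m@(suc (suc _))} {n} _ 2≤n = composite (m<m*n m n 2≤n) (m∣m*n n)
*-composite {suc zero} (s≤s ())

2≤product : ∀ {x xs} → All (2 ≤_) (x ∷ xs) → 2 ≤ product (x ∷ xs)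
2≤product 2≤xxs@(2≤x ∷ _) =
  ≤-trans 2≤x (∈⇒≤product (All.map (>-nonZero ∘ <⇒≤) 2≤xxs) (here refl))

product-composite : ∀ {s} → 2 ≤ length s → All (2 ≤_) s → Composite (product s)
product-composite {_ ∷ _ ∷ _} _ (2≤a ∷ 2≤rest) = *-composite 2≤a (2≤product 2≤rest)
product-composite {_ ∷ []} (s≤s ())

1-or-prime⇒¬composite : ∀ {p} → p ≡ 1 ⊎ Prime p → ¬ Composite p
1-or-prime⇒¬composite (inj₁ refl) c with () ← composite⇒nonTrivial c
1-or-prime⇒¬composite (inj₂ p-prime) = prime⇒¬composite p-prime

mult-pre-vanish : ∀ {k p xs} → 2 ≤ k → p ≡ 1 ⊎ Prime p → All (2 ≤_) xs → mult (pre k xs) p ≡ 0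
mult-pre-vanish {k} {p} {xs} 2≤k p-1-or-prime 2≤xs =
  cong length (filter-none (p ≟_) (All.map⁺ (All.zipWith p≢product (length-choose k xs , All-choose k 2≤xs))))
  where
  p≢product : ∀ {s} → length s ≡ k × All (2 ≤_) s → p ≢ product s
  p≢product (refl , 2≤s) p≡ = 1-or-prime⇒¬composite p-1-or-prime (subst Composite (sym p≡) (product-composite 2≤k 2≤s))

a≡sum-mult-pre : ∀ ps i k n → a ps i k n ≡ sum (map (λ λs → mult (pre k λs) i) (ps n))
a≡sum-mult-pre ps i k n = sum-map-filter (λ λs → k ≤? length λs) _ (ps n)
  (λ {λs} _ k≰ → cong (λ c → mult (map product c) i) (choose-short k λs (≰⇒> k≰)))

Linked-∷ʳ⁻ : ∀ {A : Set} {R : A → A → Set} xs {y} → Linked R (xs ∷ʳ y) → Linked R xs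
Linked-∷ʳ⁻ []           _        = []
Linked-∷ʳ⁻ (x ∷ [])     _        = [-]
Linked-∷ʳ⁻ (x ∷ y ∷ xs) (r ∷ rs) = r ∷ Linked-∷ʳ⁻ (y ∷ xs) rs

Linked≥-∷ʳ1 : ∀ {μ} → Linked _≥_ μ → All (0 <_) μ → Linked _≥_ (μ ∷ʳ 1)
Linked≥-∷ʳ1 []         []         = [-]
Linked≥-∷ʳ1 [-]        (0<x ∷ []) = 0<x ∷ [-]
Linked≥-∷ʳ1 (x≥y ∷ ≥μ) (_ ∷ 0<μ)  = x≥y ∷ Linked≥-∷ʳ1 ≥μ 0<μ

sum-∷ʳ1 : ∀ μ → sum (μ ∷ʳ 1) ≡ suc (sum μ)
sum-∷ʳ1 μ = trans (sum-++ μ (1 ∷ [])) (+-comm (sum μ) 1)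

isPartition-∷ʳ1 : ∀ {n μ} → IsPartition n μ → IsPartition (suc n) (μ ∷ʳ 1)
isPartition-∷ʳ1 {μ = μ} (≥μ , 0<μ , refl) = Linked≥-∷ʳ1 ≥μ 0<μ , All.++⁺ 0<μ (s≤s z≤n ∷ []) , sum-∷ʳ1 μ

isPartition-∷ʳ1⁻ : ∀ {n μ} → IsPartition (suc n) (μ ∷ʳ 1) → IsPartition n μ
isPartition-∷ʳ1⁻ {μ = μ} (≥μ1 , 0<μ1 , sum≡) =
  Linked-∷ʳ⁻ μ ≥μ1 , All.++⁻ˡ μ 0<μ1 , suc-injective (trans (sym (sum-∷ʳ1 μ)) sum≡)

1∈⇒≡∷ʳ1 : ∀ {l} → Linked _≥_ l → All (0 <_) l → 1 ∈ l → ∃[ μ ] l ≡ μ ∷ʳ 1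
1∈⇒≡∷ʳ1 [-] _ (here refl) = [] , refl
1∈⇒≡∷ʳ1 {x ∷ y ∷ t} (x≥y ∷ ≥l) (_ ∷ 0<l@(0<y ∷ _)) 1∈ =
  Product.map (x ∷_) (cong (x ∷_)) (1∈⇒≡∷ʳ1 ≥l 0<l (1∈tail 1∈))
  where
  1∈tail : 1 ∈ x ∷ y ∷ t → 1 ∈ y ∷ t
  1∈tail (here refl) = here (≤-antisym 0<y x≥y)
  1∈tail (there 1∈)  = 1∈

1∉⇒All≥2 : ∀ {l} → All (0 <_) l → 1 ∉ l → All (2 ≤_) l
1∉⇒All≥2 []          _   = []
1∉⇒All≥2 (0<x ∷ 0<l) 1∉ = ≤∧≢⇒< 0<x (1∉ ∘ here) ∷ 1∉⇒All≥2 0<l (1∉ ∘ there)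

module _ {ps : ℕ → List (List ℕ)} (enum : Enumerates ps) where

  isPartition : ∀ {n l} → l ∈ ps n → IsPartition n l
  isPartition {n} {l} = Equivalence.to (proj₂ (enum n) l)

  ∈partitions : ∀ {n l} → IsPartition n l → l ∈ ps n
  ∈partitions {n} {l} = Equivalence.from (proj₂ (enum n) l)

  partitions-∋1-↭ : ∀ n → filter (1 ∈?_) (ps (suc n)) ↭ map (_∷ʳ 1) (ps n)
  partitions-∋1-↭ n = ∼bag⇒↭ (unique∧set⇒bag
      (Unique.filter⁺ (1 ∈?_) (proj₁ (enum (suc n))))
      (Unique.map⁺ (λ {μ} {μ′} → ∷ʳ-injectiveˡ μ μ′) (proj₁ (enum n)))
      (mk⇔ to from))
    where
    to : ∀ {l} → l ∈ filter (1 ∈?_) (ps (suc n)) → l ∈ map (_∷ʳ 1) (ps n)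
    to l∈ with l∈ps , 1∈l ← ∈-filter⁻ (1 ∈?_) l∈
         with l-partition@(≥l , 0<l , _) ← isPartition l∈ps
         with μ , refl ← 1∈⇒≡∷ʳ1 ≥l 0<l 1∈l
      = ∈-map⁺ (_∷ʳ 1) (∈partitions (isPartition-∷ʳ1⁻ l-partition))
    from : ∀ {l} → l ∈ map (_∷ʳ 1) (ps n) → l ∈ filter (1 ∈?_) (ps (suc n))
    from l∈ with μ , μ∈ps , refl ← ∈-map⁻ (_∷ʳ 1) l∈
      = ∈-filter⁺ (1 ∈?_) (∈partitions (isPartition-∷ʳ1 (isPartition μ∈ps))) (∈-++⁺ʳ μ (here refl))

theorem3p4 : (ps : ℕ → List (List ℕ)) → Enumerates ps →
    (k p : ℕ) → 2 ≤ k → (p ≡ 1 ⊎ Prime p) → (n : ℕ) →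
    a ps p k (suc n) ≡ a ps p k n + a ps p (k ∸ 1) n
theorem3p4 ps enum (suc k) p 2≤k p-1-or-prime n = begin
  a ps p (suc k) (suc n)                        ≡⟨ a≡sum-mult-pre ps p (suc k) (suc n) ⟩
  sum (map M₊ (ps (suc n)))                     ≡⟨ sum-map-filter (1 ∈?_) M₊ (ps (suc n)) M₊-vanish ⟨
  sum (map M₊ (filter (1 ∈?_) (ps (suc n))))    ≡⟨ sum-↭ (map⁺ M₊ (partitions-∋1-↭ enum n)) ⟩
  sum (map M₊ (map (_∷ʳ 1) (ps n)))             ≡⟨ cong sum (trans (sym (map-∘ (ps n))) (map-cong (λ μ → mult-pre-∷ʳ1 k μ p) (ps n))) ⟩
  sum (map (λ μ → M₊ μ + M μ) (ps n))           ≡⟨ sum-map-+ M₊ M (ps n) ⟩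
  sum (map M₊ (ps n)) + sum (map M (ps n))      ≡⟨ cong₂ _+_ (a≡sum-mult-pre ps p (suc k) n) (a≡sum-mult-pre ps p k n) ⟨
  a ps p (suc k) n + a ps p k n                 ∎
  where
  open ≡-Reasoning
  M M₊ : List ℕ → ℕ
  M  λs = mult (pre k λs) p
  M₊ λs = mult (pre (suc k) λs) p
  M₊-vanish : ∀ {l} → l ∈ ps (suc n) → 1 ∉ l → M₊ l ≡ 0
  M₊-vanish l∈ 1∉l = mult-pre-vanish 2≤k p-1-or-prime (1∉⇒All≥2 (proj₁ (proj₂ (isPartition enum l∈))) 1∉l)
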